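{- Let $(G,k,d)$ be an instance of \textsc{Contraction(vc)} such that $G$ is connected, $k < \mathrm{rank}(G)$ and $2d \le k$. Then $(G,k,d)$ is a yes-instance if and only if $d < \mathrm{vc}(G)$.
   Context: All graphs are finite, simple and undirected. For $F \subseteq E(G)$, $G/F$ is the graph obtained by contracting all edges of $F$ (contracting $uv$ deletes $u,v$ and adds a new vertex adjacent to all former neighbours of $u$ or $v$; no loops or parallel edges). $\mathrm{vc}(G)$ is the size of a minimum vertex cover of $G$; $\mathrm{rank}(G)$ is the number of vertices of $G$ minus the number of its connected components. An instance $(G,k,d)$ of \textsc{Contraction(vc)} ($k,d$ non-negative integers) is a yes-instance iff there exists $F \subseteq E(G)$ with $|F|\le k$ and $\mathrm{vc}(G/F) \le \mathrm{vc}(G)-d$. -}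

module Defs where

open import Data.Nat using (ℕ; _≤_; _<_; _+_; _∸_)
open import Data.Fin using (Fin)
open import Data.Fin.Subset using (Subset; _∈_; ∣_∣)
open import Data.Bool using (Bool; true; false)
open import Data.List using (List; length)
open import Data.List.Membership.Propositional using () renaming (_∈_ to _∈ₗ_)
open import Data.Product using (Σ; ∃; ∃-syntax; _×_; _,_)
open import Data.Sum using (_⊎_)
open import Function.Bundles using (_⇔_)
open import Relation.Nullary using (¬_)
open import Relation.Binary.PropositionalEquality using (_≡_; _≢_)
open import Relation.Binary.Construct.Closure.ReflexiveTransitive using (Star)

record Graph : Set where
  field
    n     : ℕ
    adj   : Fin n → Fin n → Bool
    sym   : ∀ u v → adj u v ≡ adj v u
    irrefl : ∀ u → adj u u ≡ false
open Graph public

Edge : (G : Graph) → Fin (n G) → Fin (n G) → Set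
Edge G u v = adj G u v ≡ true

SymClo : ∀ {m} → (Fin m → Fin m → Set) → Fin m → Fin m → Set
SymClo E u v = E u v ⊎ E v u

Reach : ∀ {m} → (Fin m → Fin m → Set) → Fin m → Fin m → Set
Reach E = Star (SymClo E)

Connected : Graph → Set
Connected G = ∀ u v → Reach (Edge G) u v

Classes : ∀ {m} → (Fin m → Fin m → Set) → ℕ → Set
Classes {m} R c =
  Σ (Fin m → Fin c) λ π →
    (∀ a → ∃[ u ] π u ≡ a) × (∀ u v → (π u ≡ π v) ⇔ R u v)

IsRank : Graph → ℕ → Set
IsRank G r = ∃[ c ] (Classes (Reach (Edge G)) c × r ≡ n G ∸ c)

-- An edge set F ⊆ E(G), given as a list of (ordered representatives of) edges;
-- |F| is bounded by the list length.
EdgeList : Graph → Set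
EdgeList G = List (Fin (n G) × Fin (n G))

InF : ∀ {G} → EdgeList G → Fin (n G) → Fin (n G) → Set
InF F u v = (u , v) ∈ₗ F

SubsetOfE : (G : Graph) → EdgeList G → Set
SubsetOfE G F = ∀ u v → (u , v) ∈ₗ F → Edge G u v

-- H is (isomorphic to) G/F: vertices of H are the classes of the
-- equivalence "joined by a path of F-edges", and two distinct classes are
-- adjacent iff some G-edge joins them.
IsContraction : (G : Graph) → EdgeList G → Graph → Set
IsContraction G F H =
  Σ (Fin (n G) → Fin (n H)) λ π →
    (∀ a → ∃[ u ] π u ≡ a)
    × (∀ u v → (π u ≡ π v) ⇔ Reach (InF {G} F) u v)
    × (∀ a b → Edge H a b ⇔ (a ≢ b × ∃[ u ] ∃[ v ] (π u ≡ a × π v ≡ b × Edge G u v)))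

IsVertexCover : (G : Graph) → Subset (n G) → Set
IsVertexCover G S = ∀ u v → Edge G u v → u ∈ S ⊎ v ∈ S

IsVC : Graph → ℕ → Set
IsVC G c =
  (∃[ S ] (IsVertexCover G S × ∣ S ∣ ≡ c))
  × (∀ S → IsVertexCover G S → c ≤ ∣ S ∣)

-- (G,k,d) is a yes-instance of Contraction(vc):
-- ∃ F ⊆ E(G), |F| ≤ k, vc(G/F) ≤ vc(G) − d  (integer subtraction, i.e.
-- vc(G/F) + d ≤ vc(G)).
YesInstance : Graph → ℕ → ℕ → Set
YesInstance G k d =
  ∃[ F ] (SubsetOfE G F × length F ≤ k ×
    ∃[ H ] (IsContraction G F H ×
      ∃[ c ] ∃[ c' ] (IsVC G c × IsVC H c' × c' + d ≤ c)))

-- If d ≥ vc(G), a solution F would give vc(G/F) = 0, so G/F is edgeless; as G is connected,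
-- F then connects all of V(G) and |F| ≥ |V(G)| − 1 ≥ rank(G) > k.  If d < vc(G), start from a
-- minimum vertex cover S of G.  While |S| ≥ 2, the current contraction is connected, so some two
-- vertices of S are at distance at most 2 with any middle vertex outside S; contracting those one
-- or two edges merges them and drops one vertex from the cover.  After d rounds at most 2d ≤ k
-- edges are contracted and vc(G/F) ≤ vc(G) − d.

module Submission where

open import Defs hiding (sym)
open import Data.Nat using (ℕ; zero; suc; pred; _≤_; _<_; _*_; _+_; _∸_; z≤n; s≤s)
import Data.Nat.Properties as ℕ
open import Data.Fin using (Fin; zero; suc; punchIn; punchOut)
open import Data.Fin.Properties using (_≟_; any?; all?; suc-injective; injective⇒≤; punchInᵢ≢i; punchOut-punchIn; punchOut-injective; punchOut-cong)
open import Data.Fin.Subset using (Subset; _∈_; _∉_; ∣_∣; inside; outside; Nonempty)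
open import Data.Fin.Subset.Properties using (_∈?_; anySubset?)
open import Data.Vec using (_∷_; here; there; removeAt)
open import Data.Vec.Properties using (removeAt-punchOut; []=⇒lookup; lookup⇒[]=)
open import Data.Bool using (true)
open import Data.Bool.Properties using () renaming (_≟_ to _≟ᵇ_)
open import Data.List using (List; []; _∷_; length) renaming (lookup to lookupₗ)
import Data.List.Relation.Unary.Any as Any
open import Data.List.Relation.Unary.Any.Properties using (lookup-index)
open import Data.List.Membership.Propositional using () renaming (_∈_ to _∈ₗ_)
open import Data.Product using (Σ; ∃-syntax; _×_; _,_)
import Data.Product as Product
open import Data.Sum using (_⊎_; inj₁; inj₂)
import Data.Sum as Sum
open import Function using (_∘_; id)
open import Function.Bundles using (_⇔_; mk⇔; Equivalence)
open import Relation.Nullary using (¬_; Dec; yes; no; does; contradiction)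
open import Relation.Nullary.Decidable using (_×-dec_; ¬?; _→-dec_; _⊎-dec_; does-⇔; dec-true; dec-false)
open import Relation.Binary.PropositionalEquality using (_≡_; _≢_; refl; sym; trans; cong; subst)
open import Relation.Binary.Construct.Closure.ReflexiveTransitive as Star using (ε; _◅_; _◅◅_)

open Equivalence using (to; from)

private
  variable
    m m′ : ℕ

Reach-sym : {E : Fin m → Fin m → Set} {x y : Fin m} → Reach E x y → Reach E y x
Reach-sym = Star.reverse Sum.swap

Reach-map : {E E′ : Fin m → Fin m → Set} → (∀ {x y} → E x y → E′ x y) →
            ∀ {x y} → Reach E x y → Reach E′ x y
Reach-map f = Star.map (Sum.map f f)

Reach-concatMap : {E E′ : Fin m → Fin m → Set} → (∀ {x y} → E x y → Reach E′ x y) →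
                  ∀ {x y} → Reach E x y → Reach E′ x y
Reach-concatMap f = Star.kleisliStar id Sum.[ f , Reach-sym ∘ f ]

Reach-preserves : {A : Set} {E : Fin m → Fin m → Set} (f : Fin m → A) →
                  (∀ {x y} → E x y → f x ≡ f y) → ∀ {x y} → Reach E x y → f x ≡ f y
Reach-preserves f step = Star.fold (λ x y → f x ≡ f y) (λ s eq → trans (Sum.[ step , sym ∘ step ] s) eq) refl

InList : List (Fin m × Fin m) → Fin m → Fin m → Set
InList F u v = (u , v) ∈ₗ F

Reach-[] : {x y : Fin m} → Reach (InList []) x y → x ≡ y
Reach-[] ε = refl
Reach-[] (inj₁ () ◅ _)
Reach-[] (inj₂ () ◅ _)

-- Classify a walk by its last segment avoiding the new edge ab.
Reach-∷ : ∀ {a b : Fin m} {F x y} → Reach (InList ((a , b) ∷ F)) x y →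
          Reach (InList F) x y ⊎ Reach (InList F) a y ⊎ Reach (InList F) b y
Reach-∷ ε = inj₁ ε
Reach-∷ (s ◅ p) with Reach-∷ p | s
... | inj₂ q | _                       = inj₂ q
... | inj₁ q | inj₁ (Any.there e)      = inj₁ (inj₁ e ◅ q)
... | inj₁ q | inj₂ (Any.there e)      = inj₁ (inj₂ e ◅ q)
... | inj₁ q | inj₁ (Any.here refl)    = inj₂ (inj₂ q)
... | inj₁ q | inj₂ (Any.here refl)    = inj₂ (inj₁ q)

complete⇒≤length : (L : List (Fin m)) → (∀ v → v ∈ₗ L) → m ≤ length L
complete⇒≤length L complete = injective⇒≤ index-injective
  where
  index-injective : ∀ {v w} → Any.index (complete v) ≡ Any.index (complete w) → v ≡ w
  index-injective {v} {w} eq =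
    trans (lookup-index (complete v)) (trans (cong (lookupₗ L) eq) (sym (lookup-index (complete w))))

Spans : List (Fin m × Fin m) → List (Fin m) → Set
Spans F L = ∀ v → ∃[ l ] (l ∈ₗ L × Reach (InList F) l v)

private
  SpansUpTo : List (Fin m × Fin m) → List (Fin m) → Fin m → Fin m → Set
  SpansUpTo F L x y = ∀ v → ∃[ l ] (l ∈ₗ L × Reach (InList F) l v) ⊎ Reach (InList F) x v ⊎ Reach (InList F) y v

  SpansUpTo-swap : ∀ {F L} {x y : Fin m} → SpansUpTo F L x y → SpansUpTo F L y x
  SpansUpTo-swap sp v = Sum.map₂ Sum.swap (sp v)

  reroot : ∀ {F L} {x y l : Fin m} → SpansUpTo F L x y → l ∈ₗ L → Reach (InList F) l x → Spans F (y ∷ L)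
  reroot sp l∈L l⇝x v with sp v
  ... | inj₁ (l′ , l′∈L , l′⇝v) = l′ , Any.there l′∈L , l′⇝v
  ... | inj₂ (inj₁ x⇝v)        = _ , Any.there l∈L , l⇝x ◅◅ x⇝v
  ... | inj₂ (inj₂ y⇝v)        = _ , Any.here refl , y⇝v

  Spans-∷ : ∀ {a b : Fin m} {F L} → Spans ((a , b) ∷ F) L → SpansUpTo F L a b
  Spans-∷ sp v with sp v
  ... | l , l∈L , l⇝v with Reach-∷ l⇝v
  ...   | inj₁ q = inj₁ (l , l∈L , q)
  ...   | inj₂ q = inj₂ q

spans-uncons : ∀ {a b : Fin m} {F L} → Spans ((a , b) ∷ F) L → Spans F (a ∷ L) ⊎ Spans F (b ∷ L)
spans-uncons {a = a} sp with sp a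
... | l , l∈L , l⇝a with Reach-∷ (Reach-sym l⇝a)
...   | inj₁ a⇝l        = inj₂ (reroot (Spans-∷ sp) l∈L (Reach-sym a⇝l))
...   | inj₂ (inj₁ a⇝l) = inj₂ (reroot (Spans-∷ sp) l∈L (Reach-sym a⇝l))
...   | inj₂ (inj₂ b⇝l) = inj₁ (reroot (SpansUpTo-swap (Spans-∷ sp)) l∈L (Reach-sym b⇝l))

spans⇒≤ : ∀ F (L : List (Fin m)) → Spans F L → m ≤ length L + length F
spans⇒≤ [] L sp = ℕ.≤-trans (complete⇒≤length L complete) (ℕ.m≤m+n (length L) 0)
  where
  complete : ∀ v → v ∈ₗ L
  complete v with sp v
  ... | l , l∈L , l⇝v = subst (_∈ₗ L) (Reach-[] l⇝v) l∈L
spans⇒≤ ((a , b) ∷ F) L sp with spans-uncons sp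
... | inj₁ sp′ = ℕ.≤-trans (spans⇒≤ F (a ∷ L) sp′) (ℕ.≤-reflexive (sym (ℕ.+-suc (length L) (length F))))
... | inj₂ sp′ = ℕ.≤-trans (spans⇒≤ F (b ∷ L) sp′) (ℕ.≤-reflexive (sym (ℕ.+-suc (length L) (length F))))

connecting⇒≤length : (F : List (Fin m × Fin m)) → (∀ u v → Reach (InList F) u v) → m ∸ 1 ≤ length F
connecting⇒≤length {zero}  F _    = z≤n
connecting⇒≤length {suc m} F conn = ℕ.≤-pred (spans⇒≤ F (zero ∷ []) λ v → zero , Any.here refl , conn zero v)

nonempty : {p : Subset m} → 0 < ∣ p ∣ → Nonempty p
nonempty {p = inside  ∷ _} _       = zero , here
nonempty {p = outside ∷ _} 0<∣p∣ = Product.map suc there (nonempty 0<∣p∣)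

two-members : {p : Subset m} → 2 ≤ ∣ p ∣ → ∃[ x ] ∃[ y ] (x ∈ p × y ∈ p × x ≢ y)
two-members {p = inside ∷ _} (s≤s 1≤∣p∣) with nonempty 1≤∣p∣
... | y , y∈p = zero , suc y , here , there y∈p , λ ()
two-members {p = outside ∷ _} 2≤∣p∣ with two-members 2≤∣p∣
... | x , y , x∈p , y∈p , x≢y = suc x , suc y , there x∈p , there y∈p , x≢y ∘ suc-injective

delete : Subset m → Fin m → Subset (pred m)
delete {suc _} = removeAt

∣delete∣-∈ : {p : Subset m} {i : Fin m} → i ∈ p → suc ∣ delete p i ∣ ≡ ∣ p ∣
∣delete∣-∈ {p = inside  ∷ _}     here        = refl
∣delete∣-∈ {p = inside  ∷ _ ∷ _} (there i∈p) = cong suc (∣delete∣-∈ i∈p)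
∣delete∣-∈ {p = outside ∷ _ ∷ _} (there i∈p) = ∣delete∣-∈ i∈p

∣delete∣-∉ : {p : Subset m} {i : Fin m} → i ∉ p → ∣ delete p i ∣ ≡ ∣ p ∣
∣delete∣-∉ {p = inside  ∷ _}     {zero}  i∉p = contradiction here i∉p
∣delete∣-∉ {p = outside ∷ _}     {zero}  _   = refl
∣delete∣-∉ {p = inside  ∷ _ ∷ _} {suc _} i∉p = cong suc (∣delete∣-∉ (i∉p ∘ there))
∣delete∣-∉ {p = outside ∷ _ ∷ _} {suc _} i∉p = ∣delete∣-∉ (i∉p ∘ there)

∈⇒0<∣∣ : {p : Subset m} {x : Fin m} → x ∈ p → 0 < ∣ p ∣
∈⇒0<∣∣ {p = inside  ∷ _} _           = s≤s z≤n
∈⇒0<∣∣ {p = outside ∷ _} (there x∈p) = ∈⇒0<∣∣ x∈p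

IsLeastSize : (Subset m → Set) → ℕ → Set
IsLeastSize P c = (∃[ S ] (P S × ∣ S ∣ ≡ c)) × (∀ S → P S → c ≤ ∣ S ∣)

IsLeastSize-unique : {P : Subset m → Set} {c c′ : ℕ} → IsLeastSize P c → IsLeastSize P c′ → c ≡ c′
IsLeastSize-unique ((S , pS , refl) , least) ((S′ , pS′ , refl) , least′) = ℕ.≤-antisym (least S′ pS′) (least′ S pS)

least-size : {P : Subset m → Set} → (∀ S → Dec (P S)) → ∀ {S} → P S → ∃[ c ] (IsLeastSize P c × c ≤ ∣ S ∣)
least-size {P = P} P? {S} pS = search ∣ S ∣ (S , pS , ℕ.≤-refl)
  where
  search : ∀ b → ∃[ S ] (P S × ∣ S ∣ ≤ b) → ∃[ c ] (IsLeastSize P c × c ≤ b)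
  search zero    (S , pS , ∣S∣≤0) = 0 , ((S , pS , ℕ.n≤0⇒n≡0 ∣S∣≤0) , λ _ _ → z≤n) , z≤n
  search (suc b) (S , pS , ∣S∣≤1+b) with anySubset? (λ S′ → P? S′ ×-dec (∣ S′ ∣ ℕ.≤? b))
  ... | yes smaller = Product.map₂ (Product.map₂ ℕ.m≤n⇒m≤1+n) (search b smaller)
  ... | no ¬smaller = suc b , ((S , pS , ℕ.≤-antisym ∣S∣≤1+b (above S pS)) , above) , ℕ.≤-refl
    where
    above : ∀ S′ → P S′ → suc b ≤ ∣ S′ ∣
    above S′ pS′ = ℕ.≰⇒> λ ∣S′∣≤b → ¬smaller (S′ , pS′ , ∣S′∣≤b)

isVertexCover? : (H : Graph) → ∀ S → Dec (IsVertexCover H S)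
isVertexCover? H S = all? λ u → all? λ v → (adj H u v ≟ᵇ true) →-dec (u ∈? S ⊎-dec v ∈? S)

vc-≤ : (H : Graph) {S : Subset (n H)} → IsVertexCover H S → ∃[ c ] (IsVC H c × c ≤ ∣ S ∣)
vc-≤ H = least-size (isVertexCover? H)

vc≡0⇒edgeless : (H : Graph) → IsVC H 0 → ∀ a b → ¬ Edge H a b
vc≡0⇒edgeless H ((S , cover , ∣S∣≡0) , _) a b e =
  ℕ.<⇒≢ (Sum.[ ∈⇒0<∣∣ , ∈⇒0<∣∣ ] (cover a b e)) (sym ∣S∣≡0)

SymClo-Edge : (H : Graph) {u v : Fin (n H)} → SymClo (Edge H) u v → Edge H u v
SymClo-Edge H (inj₁ e) = e
SymClo-Edge H {u} {v} (inj₂ e) = trans (Graph.sym H u v) e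

data NearPair (H : Graph) (S : Subset (n H)) : Set where
  adjacent : ∀ {a b}   → a ∈ S → b ∈ S → Edge H a b → NearPair H S
  via      : ∀ {a x b} → a ∈ S → x ∉ S → b ∈ S → a ≢ b → Edge H a x → Edge H x b → NearPair H S

-- Along a walk between two cover vertices, a vertex outside S is followed by one inside S.
nearPair : (H : Graph) {S : Subset (n H)} → IsVertexCover H S →
           ∀ {s t} → s ∈ S → t ∈ S → s ≢ t → Reach (Edge H) s t → NearPair H S
nearPair H cover s∈S t∈S s≢t ε = contradiction refl s≢t
nearPair H {S} cover s∈S t∈S s≢t (_◅_ {j = y} e p) with y ∈? S
... | yes y∈S = adjacent s∈S y∈S (SymClo-Edge H e)
nearPair H cover s∈S t∈S s≢t (e ◅ ε) | no y∉S = contradiction t∈S y∉S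
nearPair H cover {s} s∈S t∈S s≢t (_◅_ {j = y} e (_◅_ {j = z} e′ p)) | no y∉S with cover y z (SymClo-Edge H e′)
... | inj₁ y∈S = contradiction y∈S y∉S
... | inj₂ z∈S with z ≟ s
...   | yes refl = nearPair H cover z∈S t∈S s≢t p
...   | no z≢s   = via s∈S y∉S z∈S (z≢s ∘ sym) (SymClo-Edge H e) (SymClo-Edge H e′)

-- Identify b with a; the other vertices are renumbered by punching out b.
merge : {a b : Fin m} → a ≢ b → Fin m → Fin (pred m)
merge {suc _} {a} {b} a≢b x with x ≟ b
... | yes _   = punchOut (a≢b ∘ sym)
... | no x≢b  = punchOut (x≢b ∘ sym)

merge-identifies : {a b : Fin m} (a≢b : a ≢ b) → merge a≢b a ≡ merge a≢b b
merge-identifies {suc _} {a} {b} a≢b with a ≟ b | b ≟ b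
... | yes a≡b | _      = contradiction a≡b a≢b
... | _       | no b≢b = contradiction refl b≢b
... | no _    | yes _  = punchOut-cong b refl

merge-surjective : {a b : Fin m} (a≢b : a ≢ b) → ∀ y → ∃[ x ] merge a≢b x ≡ y
merge-surjective {suc _} {b = b} a≢b y = punchIn b y , merge-punchIn
  where
  merge-punchIn : merge a≢b (punchIn b y) ≡ y
  merge-punchIn with punchIn b y ≟ b
  ... | yes eq = contradiction eq (punchInᵢ≢i b y)
  ... | no _   = trans (punchOut-cong b refl) (punchOut-punchIn b)

merge-kernel : {a b : Fin m} (a≢b : a ≢ b) {x y : Fin m} → merge a≢b x ≡ merge a≢b y →
               x ≡ y ⊎ (x ≡ a × y ≡ b) ⊎ (x ≡ b × y ≡ a)
merge-kernel {suc _} {b = b} a≢b {x} {y} eq with x ≟ b | y ≟ b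
... | yes refl | yes refl = inj₁ refl
... | yes refl | no y≢b   = inj₂ (inj₂ (refl , punchOut-injective (y≢b ∘ sym) (a≢b ∘ sym) (sym eq)))
... | no x≢b   | yes refl = inj₂ (inj₁ (punchOut-injective (x≢b ∘ sym) (a≢b ∘ sym) eq , refl))
... | no x≢b   | no y≢b   = inj₁ (punchOut-injective (x≢b ∘ sym) (y≢b ∘ sym) eq)

merge-∈-delete : {a b : Fin m} (a≢b : a ≢ b) {p : Subset m} {x : Fin m} →
                 a ∈ p → x ∈ p → merge a≢b x ∈ delete p b
merge-∈-delete {suc _} {b = b} a≢b {p} {x} a∈p x∈p with x ≟ b
... | yes _   = lookup⇒[]= _ _ (trans (removeAt-punchOut p (a≢b ∘ sym)) ([]=⇒lookup a∈p))
... | no x≢b  = lookup⇒[]= _ _ (trans (removeAt-punchOut p (x≢b ∘ sym)) ([]=⇒lookup x∈p))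

QuotientEdge : (G : Graph) → (Fin (n G) → Fin m) → Fin m → Fin m → Set
QuotientEdge G φ a b = a ≢ b × ∃[ u ] ∃[ v ] (φ u ≡ a × φ v ≡ b × Edge G u v)

quotientEdge? : (G : Graph) (φ : Fin (n G) → Fin m) → ∀ a b → Dec (QuotientEdge G φ a b)
quotientEdge? G φ a b =
  ¬? (a ≟ b) ×-dec any? λ u → any? λ v → (φ u ≟ a) ×-dec (φ v ≟ b) ×-dec (adj G u v ≟ᵇ true)

QuotientEdge-sym : (G : Graph) {φ : Fin (n G) → Fin m} {a b : Fin m} →
                   QuotientEdge G φ a b → QuotientEdge G φ b a
QuotientEdge-sym G (a≢b , u , v , φu≡a , φv≡b , e) = a≢b ∘ sym , v , u , φv≡b , φu≡a , trans (Graph.sym G v u) e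

_/_ : (G : Graph) → (Fin (n G) → Fin m) → Graph
_/_ {m} G φ = record
  { n      = m
  ; adj    = λ a b → does (quotientEdge? G φ a b)
  ; sym    = λ a b → does-⇔ (mk⇔ (QuotientEdge-sym G) (QuotientEdge-sym G)) (quotientEdge? G φ a b) (quotientEdge? G φ b a)
  ; irrefl = λ a → dec-false (quotientEdge? G φ a a) λ (a≢a , _) → a≢a refl
  }

/-edge : (G : Graph) (φ : Fin (n G) → Fin m) {a b : Fin m} → Edge (G / φ) a b ⇔ QuotientEdge G φ a b
/-edge G φ {a} {b} = mk⇔ (does-true (quotientEdge? G φ a b)) (dec-true (quotientEdge? G φ a b))
  where
  does-true : {A : Set} (a? : Dec A) → does a? ≡ true → A
  does-true (yes a) _ = a

module _ (G : Graph) {φ : Fin (n G) → Fin m} where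

  /-reach : ∀ {u v} → Reach (Edge G) u v → Reach (Edge (G / φ)) (φ u) (φ v)
  /-reach = Star.kleisliStar φ Sum.[ step , Reach-sym ∘ step ]
    where
    step : ∀ {u w} → Edge G u w → Reach (Edge (G / φ)) (φ u) (φ w)
    step {u} {w} e with φ u ≟ φ w
    ... | yes φu≡φw = subst (Reach (Edge (G / φ)) (φ u)) φu≡φw ε
    ... | no φu≢φw  = inj₁ (from (/-edge G φ) (φu≢φw , u , w , refl , refl , e)) ◅ ε

  /-connected : Connected G → (∀ a → ∃[ u ] φ u ≡ a) → Connected (G / φ)
  /-connected conn surj a b with surj a | surj b
  ... | u , refl | v , refl = /-reach (conn u v)

  /-cover : ∀ {m′} {S : Subset m} {S′ : Subset m′} (ψ : Fin m → Fin m′) →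
            (∀ {x} → x ∈ S → ψ x ∈ S′) → IsVertexCover (G / φ) S → IsVertexCover (G / (ψ ∘ φ)) S′
  /-cover ψ ψ[S]⊆S′ cover a b e with to (/-edge G (ψ ∘ φ)) e
  ... | a≢b , u , v , refl , refl , eG =
    Sum.map ψ[S]⊆S′ ψ[S]⊆S′ (cover (φ u) (φ v) (from (/-edge G φ) (a≢b ∘ cong ψ , u , v , refl , refl , eG)))

KernelIs : {A B : Set} → (A → B) → (A → A → Set) → Set
KernelIs φ R = ∀ u v → (φ u ≡ φ v) ⇔ R u v

-- Contracting the extra edge u₀v₀ of G/F is merging its two end classes.
KernelIs-∷ : {φ : Fin m → Fin m′} {F : List (Fin m × Fin m)} → KernelIs φ (Reach (InList F)) →
             ∀ {u₀ v₀} (φu₀≢φv₀ : φ u₀ ≢ φ v₀) → KernelIs (merge φu₀≢φv₀ ∘ φ) (Reach (InList ((u₀ , v₀) ∷ F)))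
KernelIs-∷ {φ = φ} kernel {u₀} {v₀} φu₀≢φv₀ u v = mk⇔ merged⇒reach (Reach-preserves (merge φu₀≢φv₀ ∘ φ) step)
  where
  old : ∀ {x y} → φ x ≡ φ y → Reach (InList ((u₀ , v₀) ∷ _)) x y
  old eq = Reach-map Any.there (to (kernel _ _) eq)

  merged⇒reach : merge φu₀≢φv₀ (φ u) ≡ merge φu₀≢φv₀ (φ v) → Reach (InList ((u₀ , v₀) ∷ _)) u v
  merged⇒reach eq with merge-kernel φu₀≢φv₀ eq
  ... | inj₁ φu≡φv = old φu≡φv
  ... | inj₂ (inj₁ (φu≡φu₀ , φv≡φv₀)) = old φu≡φu₀ ◅◅ inj₁ (Any.here refl) ◅ old (sym φv≡φv₀)
  ... | inj₂ (inj₂ (φu≡φv₀ , φv≡φu₀)) = old φu≡φv₀ ◅◅ inj₂ (Any.here refl) ◅ old (sym φv≡φu₀)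

  step : ∀ {x y} → InList ((u₀ , v₀) ∷ _) x y → merge φu₀≢φv₀ (φ x) ≡ merge φu₀≢φv₀ (φ y)
  step (Any.here refl) = merge-identifies φu₀≢φv₀
  step (Any.there e)   = cong (merge φu₀≢φv₀) (from (kernel _ _) (inj₁ e ◅ ε))

record CoveredContraction (G : Graph) : Set where
  field
    F            : EdgeList G
    F⊆E          : SubsetOfE G F
    {classes}    : ℕ
    φ            : Fin (n G) → Fin classes
    φ-surjective : ∀ a → ∃[ u ] φ u ≡ a
    φ-kernel     : KernelIs φ (Reach (InF {G} F))
    S            : Subset classes
    S-cover      : IsVertexCover (G / φ) S

  isContraction : IsContraction G F (G / φ)
  isContraction = φ , φ-surjective , φ-kernel , λ _ _ → /-edge G φ

open CoveredContraction

uncontracted : {G : Graph} {S : Subset (n G)} → IsVertexCover G S → CoveredContraction G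
uncontracted {G} {S} cover = record
  { F            = []
  ; F⊆E          = λ _ _ ()
  ; φ            = id
  ; φ-surjective = λ a → a , refl
  ; φ-kernel     = λ u v → mk⇔ (λ { refl → ε }) Reach-[]
  ; S            = S
  ; S-cover      = id-cover
  }
  where
  id-cover : IsVertexCover (G / id) S
  id-cover a b e with to (/-edge G id) e
  ... | _ , u , v , refl , refl , eG = cover u v eG

-- The class of v is merged into that of u, so it can be dropped from the cover.
contract : {G : Graph} (C : CoveredContraction G) {u v : Fin (n G)} → Edge G u v →
           (φu≢φv : φ C u ≢ φ C v) → φ C u ∈ S C → CoveredContraction G
contract {G} C {u} {v} e φu≢φv φu∈S = record
  { F            = (u , v) ∷ F C
  ; F⊆E          = F⊆E′
  ; φ            = merge φu≢φv ∘ φ C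
  ; φ-surjective = surjective
  ; φ-kernel     = KernelIs-∷ (φ-kernel C) φu≢φv
  ; S            = delete (S C) (φ C v)
  ; S-cover      = /-cover G (merge φu≢φv) (merge-∈-delete φu≢φv φu∈S) (S-cover C)
  }
  where
  F⊆E′ : SubsetOfE G ((u , v) ∷ F C)
  F⊆E′ _ _ (Any.here refl) = e
  F⊆E′ x y (Any.there xy∈F) = F⊆E C x y xy∈F

  surjective : ∀ a → ∃[ x ] merge φu≢φv (φ C x) ≡ a
  surjective a with merge-surjective φu≢φv a
  ... | b , merge-b≡a with φ-surjective C b
  ...   | x , φx≡b = x , trans (cong (merge φu≢φv) φx≡b) merge-b≡a

Saving : Graph → ℕ → ℕ → Set
Saving G j c = Σ (CoveredContraction G) λ C → length (F C) ≤ 2 * j × ∣ S C ∣ + j ≡ c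

private
  ≤2*suc : ∀ {l} j → l ≤ 2 * j → 2 + l ≤ 2 * suc j
  ≤2*suc {l} j l≤2j = subst (2 + l ≤_) (sym (ℕ.*-suc 2 j)) (s≤s (s≤s l≤2j))

  saved-one : ∀ {s′ s} j {c} → suc s′ ≡ s → s + j ≡ c → s′ + suc j ≡ c
  saved-one j s′+1≡s s+j≡c = trans (ℕ.+-suc _ j) (trans (cong (_+ j) s′+1≡s) s+j≡c)

save-adjacent : ∀ {G j c} (C : CoveredContraction G) → length (F C) ≤ 2 * j → ∣ S C ∣ + j ≡ c →
                ∀ {a b} → a ∈ S C → b ∈ S C → Edge (G / φ C) a b → Saving G (suc j) c
save-adjacent {G} {j} C |F|≤2j |S|+j≡c a∈S b∈S e with to (/-edge G (φ C)) e
... | a≢b , u , v , refl , refl , eG =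
  contract C eG a≢b a∈S , ℕ.≤-trans (ℕ.n≤1+n _) (≤2*suc j |F|≤2j) , saved-one j (∣delete∣-∈ b∈S) |S|+j≡c

-- First merge x into a (free, as x ∉ S), then b into the merged class.
save-via : ∀ {G j c} (C : CoveredContraction G) → length (F C) ≤ 2 * j → ∣ S C ∣ + j ≡ c →
           ∀ {a x b} → a ∈ S C → x ∉ S C → b ∈ S C → a ≢ b →
           Edge (G / φ C) a x → Edge (G / φ C) x b → Saving G (suc j) c
save-via {G} {j} C |F|≤2j |S|+j≡c a∈S x∉S b∈S a≢b ax xb with to (/-edge G (φ C)) ax | to (/-edge G (φ C)) xb
... | a≢x , u₁ , v₁ , refl , refl , e₁ | x≢b , u₂ , v₂ , φu₂≡x , refl , e₂ =
  C₂ , ≤2*suc j |F|≤2j , saved-one j (trans (∣delete∣-∈ b∈S₁) (∣delete∣-∉ x∉S)) |S|+j≡c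
  where
  C₁ : CoveredContraction G
  C₁ = contract C e₁ a≢x a∈S

  a∈S₁ : φ C₁ u₁ ∈ S C₁
  a∈S₁ = merge-∈-delete a≢x a∈S a∈S

  b∈S₁ : φ C₁ v₂ ∈ S C₁
  b∈S₁ = merge-∈-delete a≢x a∈S b∈S

  u₂≈u₁ : φ C₁ u₂ ≡ φ C₁ u₁
  u₂≈u₁ = trans (cong (merge a≢x) φu₂≡x) (sym (merge-identifies a≢x))

  u₂≉v₂ : φ C₁ u₂ ≢ φ C₁ v₂
  u₂≉v₂ eq with merge-kernel a≢x (trans (sym u₂≈u₁) eq)
  ... | inj₁ a≡b              = a≢b a≡b
  ... | inj₂ (inj₁ (_ , b≡x)) = x≢b (sym b≡x)
  ... | inj₂ (inj₂ (a≡x , _)) = a≢x a≡x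

  C₂ : CoveredContraction G
  C₂ = contract C₁ e₂ u₂≉v₂ (subst (_∈ S C₁) (sym u₂≈u₁) a∈S₁)

save-one : ∀ {G j c} → Connected G → Saving G j c → suc j < c → Saving G (suc j) c
save-one {G} {j} conn (C , |F|≤2j , |S|+j≡c) 1+j<c
  with two-members (ℕ.+-cancelʳ-≤ j 2 ∣ S C ∣ (subst (2 + j ≤_) (sym |S|+j≡c) 1+j<c))
... | s , t , s∈S , t∈S , s≢t
  with nearPair (G / φ C) (S-cover C) s∈S t∈S s≢t (/-connected G conn (φ-surjective C) s t)
... | adjacent a∈S b∈S ab           = save-adjacent C |F|≤2j |S|+j≡c a∈S b∈S ab
... | via a∈S x∉S b∈S a≢b ax xb     = save-via C |F|≤2j |S|+j≡c a∈S x∉S b∈S a≢b ax xb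

saving : ∀ {G c} → Connected G → IsVC G c → ∀ j → j < c → Saving G j c
saving conn ((S , cover , ∣S∣≡c) , _) zero    _   = uncontracted cover , z≤n , trans (ℕ.+-identityʳ _) ∣S∣≡c
saving conn vc                          (suc j) j<c = save-one conn (saving conn vc j (ℕ.<-trans (ℕ.n<1+n j) j<c)) j<c

rank≤n∸1 : (G : Graph) {r : ℕ} → IsRank G r → r ≤ n G ∸ 1
rank≤n∸1 G (_ , (π , _) , refl) = classes≥1 π
  where
  classes≥1 : ∀ {N c} → (Fin N → Fin c) → N ∸ c ≤ N ∸ 1
  classes≥1 {zero} {c} _ = ℕ.≤-reflexive (ℕ.0∸n≡0 c)
  classes≥1 {suc N} {zero}  π with π zero
  ... | ()
  classes≥1 {suc N} {suc c} _ = ℕ.∸-monoʳ-≤ {1} {suc c} (suc N) (s≤s z≤n)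

edgeless-contraction⇒connecting : {G H : Graph} {F : EdgeList G} → Connected G → IsContraction G F H →
                                  (∀ a b → ¬ Edge H a b) → ∀ u v → Reach (InF {G} F) u v
edgeless-contraction⇒connecting {G} conn (π , _ , kernel , edges) edgeless u v =
  Reach-concatMap (λ {x} {y} e → to (kernel x y) (same-class e)) (conn u v)
  where
  same-class : ∀ {x y} → Edge G x y → π x ≡ π y
  same-class {x} {y} e with π x ≟ π y
  ... | yes πx≡πy = πx≡πy
  ... | no πx≢πy  = contradiction (from (edges _ _) (πx≢πy , x , y , refl , refl , e)) (edgeless _ _)

yes⇒d<c : ∀ {G k d r c} → Connected G → IsRank G r → IsVC G c → k < r → YesInstance G k d → d < c
yes⇒d<c {G} {k} {d} {r} {c} conn rank vc k<r (F , _ , |F|≤k , H , contraction , c₁ , c′ , vc₁ , vc′ , c′+d≤c₁)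
  with d ℕ.<? c
... | yes d<c = d<c
... | no d≮c  = contradiction r≤k (ℕ.<⇒≱ k<r)
  where
  open ℕ.≤-Reasoning

  c′≡0 : c′ ≡ 0
  c′≡0 = ℕ.n≤0⇒n≡0 (ℕ.+-cancelʳ-≤ d c′ 0 (begin
    c′ + d ≤⟨ c′+d≤c₁ ⟩
    c₁     ≡⟨ IsLeastSize-unique vc₁ vc ⟩
    c      ≤⟨ ℕ.≮⇒≥ d≮c ⟩
    d      ∎))

  F-connects : ∀ u v → Reach (InF {G} F) u v
  F-connects = edgeless-contraction⇒connecting {G} {H} conn contraction
                 (vc≡0⇒edgeless H (subst (IsVC H) c′≡0 vc′))

  r≤k : r ≤ k
  r≤k = begin
    r        ≤⟨ rank≤n∸1 G rank ⟩
    n G ∸ 1  ≤⟨ connecting⇒≤length F F-connects ⟩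
    length F ≤⟨ |F|≤k ⟩
    k        ∎

d<c⇒yes : ∀ {G k d c} → Connected G → IsVC G c → 2 * d ≤ k → d < c → YesInstance G k d
d<c⇒yes {G} {d = d} conn vc 2d≤k d<c with saving {G} conn vc d d<c
... | C , |F|≤2d , |S|+d≡c with vc-≤ (G / φ C) (S-cover C)
... | c′ , vc′ , c′≤|S| =
  F C , F⊆E C , ℕ.≤-trans |F|≤2d 2d≤k , G / φ C , isContraction C ,
  _ , c′ , vc , vc′ , ℕ.≤-trans (ℕ.+-monoˡ-≤ d c′≤|S|) (ℕ.≤-reflexive |S|+d≡c)

mainTheorem6 : (G : Graph) (k d r c : ℕ) → Connected G → IsRank G r → IsVC G c →
    k < r → 2 * d ≤ k → (YesInstance G k d ⇔ d < c)
mainTheorem6 G k d r c conn rank vc k<r 2d≤k = mk⇔ (yes⇒d<c {G} conn rank vc k<r) (d<c⇒yes {G} conn vc 2d≤k)
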